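{- For all $n\geq 3$, $$\tau(n)\leq\tau_c(n)\leq\left\lceil\frac{\log\big(n(n-1)(n-2)\big)-\log 2}{\log(3/2)}\right\rceil.$$
   Context: A binary rooted phylogenetic tree of order $n$ is a rooted tree, edges directed away from the root, root of out-degree 2, other internal vertices of in-degree 1 and out-degree 2, with $n$ leaves bijectively labelled by $\{1,\dots,n\}$. A caterpillar is such a tree with exactly one cherry (pair of leaves with a common parent). A tree $T$ displays the triplet $ab|c$ if $\mathrm{lca}_{T}(a,c)=\mathrm{lca}_{T}(b,c)$ is a proper ancestor of $\mathrm{lca}_{T}(a,b)$. $\mathcal{T}_n=\{ab|c: a,b,c\in\{1,\dots,n\}\text{ pairwise distinct}\}$ (with $ab|c=ba|c$). $\tau(n)$ (resp. $\tau_c(n)$) is the minimum number of binary rooted phylogenetic trees (resp. caterpillars) of order $n$ such that each triplet in $\mathcal{T}_n$ is displayed by at least one of them. Logarithms may be taken to any fixed base. -}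

module Defs where

open import Data.Nat using (ℕ; zero; suc; _+_; _*_; _∸_; _^_; _≤_; _<_)
open import Data.Fin using (Fin)
open import Data.List using (List; []; _∷_; _++_; allFin; length)
open import Data.List.Membership.Propositional using (_∈_)
open import Data.List.Relation.Unary.Any using (Any)
open import Data.List.Relation.Binary.Permutation.Propositional using (_↭_)
open import Data.Product using (_×_)
open import Data.Sum using (_⊎_)
open import Relation.Binary.PropositionalEquality using (_≡_)
open import Relation.Nullary using (¬_)

-- Edges are directed away from the root; every internal node has exactly
-- two children (the order of the two children is irrelevant for everything below).
data Tree (n : ℕ) : Set where
  leaf : Fin n → Tree n
  node : Tree n → Tree n → Tree n

leaves : ∀ {n} → Tree n → List (Fin n)
leaves (leaf x)   = x ∷ []
leaves (node l r) = leaves l ++ leaves r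

IsPhylo : ∀ {n} → Tree n → Set
IsPhylo {n} T = leaves T ↭ allFin n

cherries : ∀ {n} → Tree n → ℕ
cherries (leaf _)                 = 0
cherries (node (leaf _) (leaf _)) = 1
cherries (node l r)               = cherries l + cherries r

IsCaterpillar : ∀ {n} → Tree n → Set
IsCaterpillar T = IsPhylo T × cherries T ≡ 1

-- T displays ab|c : lca(a,c) = lca(b,c) is a proper ancestor of lca(a,b),
-- i.e. at the vertex where c separates from {a,b}, a and b lie below one child
-- and c below the other.
Displays : ∀ {n} → Tree n → Fin n → Fin n → Fin n → Set
Displays (leaf _)   a b c = Data.Empty.⊥
  where import Data.Empty
Displays (node l r) a b c =
    Displays l a b c
  ⊎ Displays r a b c
  ⊎ (a ∈ leaves l × b ∈ leaves l × c ∈ leaves r)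
  ⊎ (a ∈ leaves r × b ∈ leaves r × c ∈ leaves l)

CoversTriplets : ∀ {n} → List (Tree n) → Set
CoversTriplets {n} Ts =
  (a b c : Fin n) → ¬ a ≡ b → ¬ a ≡ c → ¬ b ≡ c →
  Any (λ T → Displays T a b c) Ts

-- "τ(n) ≤ m": some m phylogenetic trees of order n display all triplets
TreeCoverable : ℕ → ℕ → Set
TreeCoverable n m =
  Data.Product.Σ (List (Tree n)) λ Ts →
    length Ts ≡ m × Data.List.Relation.Unary.All.All IsPhylo Ts × CoversTriplets Ts
  where import Data.Product
        import Data.List.Relation.Unary.All

-- "τ_c(n) ≤ m": some m caterpillars of order n display all triplets
CatCoverable : ℕ → ℕ → Set
CatCoverable n m =
  Data.Product.Σ (List (Tree n)) λ Ts →
    length Ts ≡ m × Data.List.Relation.Unary.All.All IsCaterpillar Ts × CoversTriplets Ts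
  where import Data.Product
        import Data.List.Relation.Unary.All

-- k ≥ log(n(n-1)(n-2)/2)/log(3/2)  ⇔  (3/2)^k ≥ n(n-1)(n-2)/2
--                                   ⇔  2^k · n(n-1)(n-2) ≤ 2 · 3^k
AboveBound : ℕ → ℕ → Set
AboveBound n k = 2 ^ k * (n * (n ∸ 1) * (n ∸ 2)) ≤ 2 * 3 ^ k

-- k = ⌈ (log(n(n-1)(n-2)) - log 2) / log(3/2) ⌉  (the least such k)
IsCeilBound : ℕ → ℕ → Set
IsCeilBound n k = AboveBound n k × ((j : ℕ) → j < k → ¬ AboveBound n j)

module Submission where

-- A caterpillar is determined by the order in which its leaves split off from
-- the spine, and the caterpillar read off an ordering r displays ab|c as soon
-- as c comes before both a and b in r.  So it suffices to find few orderings
-- of {1,…,n} such that for all distinct a, b, c one of them puts c before a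
-- and b; we call such a family separating (it must also put a before b for
-- all distinct a, b, which the construction needs as an invariant).
--
-- Separating families are built by doubling: the three rotations separate any
-- set of size ≤ 3, and separating families FA, FB of equal size k for SA and
-- SB give the size-(k+2) family
--     SB ++ SA,  reverse SB ++ SA,  and the member-wise concatenations FA ⊗ FB
-- for SA ++ SB.  Hence every set of size ≤ 3·2^d has a separating family of
-- 2d+3 orderings.  An arithmetic estimate shows that whenever k satisfies the
-- bound of the theorem (and n ≥ 3) there is d with n ≤ 3·2^d and 2d+3 ≤ k;
-- padding the family to exactly k orderings and reading off caterpillars
-- proves τ_c(n) ≤ k.  The inequality τ(n) ≤ τ_c(n) holds because every
-- caterpillar is a phylogenetic tree.

open import Defs
open import Function using (_∘_; id)
open import Data.Nat
  using (ℕ; zero; suc; _+_; _*_; _∸_; _^_; _⊓_; _≤_; _<_; _≤?_; _<?_; z≤n; s≤s; NonZero; >-nonZero)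
open import Data.Nat.Properties
  using ( ≤-refl; ≤-reflexive; ≤-trans; <⇒≤; <⇒≱; ≮⇒≥; n≤1+n; m≤n+m; m⊓n≤m; ⊓-idem
        ; m+n∸m≡n; m∸n+n≡m; ∸-monoˡ-≤; suc-injective; +-identityʳ; *-identityʳ; *-assoc
        ; *-mono-≤; *-monoʳ-≤; *-monoˡ-≤; *-monoˡ-<; m^n>0; module ≤-Reasoning)
open import Data.Nat.Tactic.RingSolver using (solve-∀)
open import Data.Fin as Fin using (Fin)
open import Data.List
  using (List; []; _∷_; [_]; _++_; _∷ʳ_; length; map; zipWith; reverse; replicate; take; drop; allFin)
open import Data.List.Properties
  using (length-map; length-++; length-replicate; length-tabulate; length-take; length-drop
        ; length-zipWith; take++drop≡id; unfold-reverse)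
open import Data.List.Membership.Propositional using (_∈_)
open import Data.List.Membership.Propositional.Properties using (∈-++⁻; ∈-allFin)
open import Data.List.Relation.Unary.Any as Any using (Any; here; there)
import Data.List.Relation.Unary.Any.Properties as Any
open import Data.List.Relation.Unary.All as All using (All; []; _∷_)
import Data.List.Relation.Unary.All.Properties as All
open import Data.List.Relation.Binary.Permutation.Propositional
  using (_↭_; ↭-refl; ↭-sym; ↭-trans)
open import Data.List.Relation.Binary.Permutation.Propositional.Properties
  using (∈-resp-↭; ++-comm; ++⁺; ++⁺ʳ; ∷↭∷ʳ; ↭-reverse; ↭-length)
open import Data.Product using (Σ-syntax; ∃-syntax; _×_; _,_; proj₁; swap)
import Data.Product as Product
open import Data.Sum using (_⊎_; inj₁; inj₂)
import Data.Sum as Sum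
open import Relation.Binary.PropositionalEquality
  using (_≡_; _≢_; refl; sym; trans; cong; subst; module ≡-Reasoning)
open import Relation.Nullary using (contradiction)
open import Relation.Nullary.Decidable using (from-yes; from-no)

module _ {A : Set} where

  infix 4 _≺_∈_
  data _≺_∈_ (c a : A) : List A → Set where
    here  : ∀ {xs} → a ∈ xs → c ≺ a ∈ c ∷ xs
    there : ∀ {x xs} → c ≺ a ∈ xs → c ≺ a ∈ x ∷ xs

  ≺-∈ˡ : ∀ {c a xs} → c ≺ a ∈ xs → c ∈ xs
  ≺-∈ˡ (here _)  = here refl
  ≺-∈ˡ (there p) = there (≺-∈ˡ p)

  ≺-∈ʳ : ∀ {c a xs} → c ≺ a ∈ xs → a ∈ xs
  ≺-∈ʳ (here m)  = there m
  ≺-∈ʳ (there p) = there (≺-∈ʳ p)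

  ≺-++ʳ : ∀ {c a xs} ys → c ≺ a ∈ xs → c ≺ a ∈ xs ++ ys
  ≺-++ʳ ys (here m)  = here (Any.++⁺ˡ m)
  ≺-++ʳ ys (there p) = there (≺-++ʳ ys p)

  ≺-++ˡ : ∀ {c a xs} ys → c ≺ a ∈ xs → c ≺ a ∈ ys ++ xs
  ≺-++ˡ []       p = p
  ≺-++ˡ (y ∷ ys) p = there (≺-++ˡ ys p)

  ≺-across : ∀ {c a} xs {ys} → c ∈ xs → a ∈ ys → c ≺ a ∈ xs ++ ys
  ≺-across (x ∷ xs) (here refl) a∈ys = here (Any.++⁺ʳ xs a∈ys)
  ≺-across (x ∷ xs) (there c∈xs) a∈ys = there (≺-across xs c∈xs a∈ys)

  ≺-head : ∀ {c a t} → a ∈ c ∷ t → a ≢ c → c ≺ a ∈ c ∷ t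
  ≺-head (here a≡c) a≢c = contradiction a≡c a≢c
  ≺-head (there a∈t) _  = here a∈t

  ≺-total : ∀ {a c xs} → a ∈ xs → c ∈ xs → a ≢ c → c ≺ a ∈ xs ⊎ a ≺ c ∈ xs
  ≺-total (here refl) (here refl)  a≢c = contradiction refl a≢c
  ≺-total (here refl) (there c∈xs) _   = inj₂ (here c∈xs)
  ≺-total (there a∈xs) (here refl) _   = inj₁ (here a∈xs)
  ≺-total (there a∈xs) (there c∈xs) a≢c = Sum.map there there (≺-total a∈xs c∈xs a≢c)

  ≺-reverse : ∀ {a c xs} → a ≺ c ∈ xs → c ≺ a ∈ reverse xs
  ≺-reverse {xs = x ∷ xs} (here c∈xs) rewrite unfold-reverse x xs =
    ≺-across (reverse xs) (Any.reverse⁺ c∈xs) (here refl)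
  ≺-reverse {xs = x ∷ xs} (there p) rewrite unfold-reverse x xs =
    ≺-++ʳ [ x ] (≺-reverse p)

  PrecedesBoth : A → A → A → List A → Set
  PrecedesBoth c a b r = c ≺ a ∈ r × c ≺ b ∈ r

  Family : Set
  Family = List (List A)

  record Separating (S : List A) (F : Family) : Set where
    constructor separating
    field
      orderings : All (_↭ S) F
      pairs     : ∀ {a b} → a ∈ S → b ∈ S → a ≢ b → Any (a ≺ b ∈_) F
      triples   : ∀ {a b c} → a ∈ S → b ∈ S → c ∈ S → a ≢ b → a ≢ c → b ≢ c →
                  Any (PrecedesBoth c a b) F

  Separable : List A → ℕ → Set
  Separable S k = Σ[ F ∈ Family ] length F ≡ k × Separating S F

  all-any : ∀ {P Q : List A → Set} {F : Family} →
            All P F → Any Q F → Any (λ r → P r × Q r) F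
  all-any (p ∷ _)  (here q)  = here (p , q)
  all-any (_ ∷ ps) (there q) = there (all-any ps q)

  data Leads (c : A) : List A → Set where
    leads : ∀ {t} → Leads c (c ∷ t)

  leaders-separate : ∀ {S F} → All (_↭ S) F → (∀ {c} → c ∈ S → Any (Leads c) F) →
                     Separating S F
  leaders-separate {S} {F} perms lead = separating perms pairs triples
    where
    precedes-rest : ∀ {c a r} → a ∈ S → a ≢ c → r ↭ S × Leads c r → c ≺ a ∈ r
    precedes-rest a∈S a≢c (r↭S , leads) = ≺-head (∈-resp-↭ (↭-sym r↭S) a∈S) a≢c

    pairs : ∀ {a b} → a ∈ S → b ∈ S → a ≢ b → Any (a ≺ b ∈_) F
    pairs a∈S b∈S a≢b = Any.map (precedes-rest b∈S (a≢b ∘ sym)) (all-any perms (lead a∈S))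

    triples : ∀ {a b c} → a ∈ S → b ∈ S → c ∈ S → a ≢ b → a ≢ c → b ≢ c →
              Any (PrecedesBoth c a b) F
    triples a∈S b∈S c∈S _ a≢c b≢c =
      Any.map (λ h → precedes-rest a∈S a≢c h , precedes-rest b∈S b≢c h)
              (all-any perms (lead c∈S))

  rotate : List A → List A
  rotate []       = []
  rotate (x ∷ xs) = xs ∷ʳ x

  rotations : List A → Family
  rotations S = S ∷ rotate S ∷ rotate (rotate S) ∷ []

  rotate-↭ : ∀ xs → rotate xs ↭ xs
  rotate-↭ []       = ↭-refl
  rotate-↭ (x ∷ xs) = ↭-sym (∷↭∷ʳ x xs)

  rotations-lead : ∀ S → length S ≤ 3 → ∀ {c} → c ∈ S → Any (Leads c) (rotations S)
  rotations-lead (_ ∷ _)         _ (here refl)                 = here leads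
  rotations-lead (_ ∷ _ ∷ _)     _ (there (here refl))         = there (here leads)
  rotations-lead (_ ∷ _ ∷ _ ∷ _) _ (there (there (here refl))) = there (there (here leads))
  rotations-lead (_ ∷ _ ∷ _ ∷ _ ∷ _) (s≤s (s≤s (s≤s ()))) (there (there (there _)))

  rotations-separable : ∀ S → length S ≤ 3 → Separable S 3
  rotations-separable S small =
    rotations S , refl ,
    leaders-separate (↭-refl ∷ rotate-↭ S ∷ ↭-trans (rotate-↭ (rotate S)) (rotate-↭ S) ∷ [])
                     (rotations-lead S small)

  data Split (P Q : List A → Set) : List A → Set where
    split : ∀ {α β} → P α → Q β → Split P Q (α ++ β)

  split-elim : ∀ {P Q G : List A → Set} → (∀ {α β} → P α → Q β → G (α ++ β)) →
               ∀ {r} → Split P Q r → G r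
  split-elim f (split p q) = f p q

  zipWith-All : ∀ {P Q : List A → Set} {FA FB : Family} →
                All P FA → All Q FB → All (Split P Q) (zipWith _++_ FA FB)
  zipWith-All []       _        = []
  zipWith-All (_ ∷ _)  []       = []
  zipWith-All (p ∷ ps) (q ∷ qs) = split p q ∷ zipWith-All ps qs

  zipWith-Anyˡ : ∀ {P Q : List A → Set} {FA FB : Family} → length FA ≡ length FB →
                 Any P FA → All Q FB → Any (Split P Q) (zipWith _++_ FA FB)
  zipWith-Anyˡ eq (here p)  (q ∷ _)  = here (split p q)
  zipWith-Anyˡ eq (there p) (_ ∷ qs) = there (zipWith-Anyˡ (suc-injective eq) p qs)
  zipWith-Anyˡ () (here _)  []
  zipWith-Anyˡ () (there _) []

  zipWith-Anyʳ : ∀ {P Q : List A → Set} {FA FB : Family} → length FA ≡ length FB →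
                 All P FA → Any Q FB → Any (Split P Q) (zipWith _++_ FA FB)
  zipWith-Anyʳ eq (p ∷ _)  (here q)  = here (split p q)
  zipWith-Anyʳ eq (_ ∷ ps) (there q) = there (zipWith-Anyʳ (suc-injective eq) ps q)
  zipWith-Anyʳ () []       (here _)
  zipWith-Anyʳ () []       (there _)

  -- Merging separating families FA of SA and FB of SB of the same length.  The
  -- mixed cases need some member of FA, supplied as someA.
  module Merge {SA SB : List A} {FA FB : Family} (same-length : length FA ≡ length FB)
               (sepA : Separating SA FA) (sepB : Separating SB FB) where
    open Separating sepA renaming (orderings to permsA; pairs to pairsA; triples to triplesA)
    open Separating sepB renaming (orderings to permsB; pairs to pairsB; triples to triplesB)

    merged : Family
    merged = (SB ++ SA) ∷ (reverse SB ++ SA) ∷ zipWith _++_ FA FB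

    length-merged : length merged ≡ 2 + length FA
    length-merged = cong (2 +_) (begin
      length (zipWith _++_ FA FB) ≡⟨ length-zipWith _++_ FA FB ⟩
      length FA ⊓ length FB       ≡⟨ cong (length FA ⊓_) (sym same-length) ⟩
      length FA ⊓ length FA       ≡⟨ ⊓-idem (length FA) ⟩
      length FA                   ∎)
      where open ≡-Reasoning

    member : ∀ {x : A} {S α} → x ∈ S → α ↭ S → x ∈ α
    member x∈S α↭S = ∈-resp-↭ (↭-sym α↭S) x∈S

    viaA : ∀ {P G : List A → Set} → Any P FA → (∀ {α β} → P α → β ↭ SB → G (α ++ β)) →
           Any G merged
    viaA p f = there (there (Any.map (split-elim f) (zipWith-Anyˡ same-length p permsB)))

    viaB : ∀ {Q G : List A → Set} → Any Q FB → (∀ {α β} → α ↭ SA → Q β → G (α ++ β)) →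
           Any G merged
    viaB q f = there (there (Any.map (split-elim f) (zipWith-Anyʳ same-length permsA q)))

    orderings : All (_↭ SA ++ SB) merged
    orderings = ++-comm SB SA
              ∷ ↭-trans (++⁺ʳ SA (↭-reverse SB)) (++-comm SB SA)
              ∷ All.map (split-elim ++⁺) (zipWith-All permsA permsB)

    module _ (someA : Any (_↭ SA) FA) where

      first-block : ∀ {a b c} → a ∈ SA → c ∈ SA → b ∈ SB → a ≢ c →
                    Any (PrecedesBoth c a b) merged
      first-block aA cA bB a≢c =
        viaA (pairsA cA aA (a≢c ∘ sym))
             (λ {α} {β} ca β↭ → ≺-++ʳ β ca , ≺-across α (≺-∈ˡ ca) (member bB β↭))

      -- c, a ∈ SB and b ∈ SA: SB ++ SA or reverse SB ++ SA, whichever has c before a.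
      second-block : ∀ {a b c} → a ∈ SB → c ∈ SB → b ∈ SA → a ≢ c →
                     Any (PrecedesBoth c a b) merged
      second-block aB cB bA a≢c with ≺-total aB cB a≢c
      ... | inj₁ ca = here (≺-++ʳ SA ca , ≺-across SB cB bA)
      ... | inj₂ ac = there (here (≺-++ʳ SA (≺-reverse ac) ,
                                   ≺-across (reverse SB) (Any.reverse⁺ cB) bA))

      pairs : ∀ {a b} → a ∈ SA ++ SB → b ∈ SA ++ SB → a ≢ b → Any (a ≺ b ∈_) merged
      pairs a∈ b∈ a≢b with ∈-++⁻ SA a∈ | ∈-++⁻ SA b∈
      ... | inj₁ aA | inj₁ bA = viaA (pairsA aA bA a≢b) (λ {_} {β} ab _ → ≺-++ʳ β ab)
      ... | inj₁ aA | inj₂ bB = viaA someA (λ {α} α↭ β↭ → ≺-across α (member aA α↭) (member bB β↭))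
      ... | inj₂ aB | inj₁ bA = here (≺-across SB aB bA)
      ... | inj₂ aB | inj₂ bB = viaB (pairsB aB bB a≢b) (λ {α} _ ab → ≺-++ˡ α ab)

      triples : ∀ {a b c} → a ∈ SA ++ SB → b ∈ SA ++ SB → c ∈ SA ++ SB →
                a ≢ b → a ≢ c → b ≢ c → Any (PrecedesBoth c a b) merged
      triples a∈ b∈ c∈ a≢b a≢c b≢c with ∈-++⁻ SA a∈ | ∈-++⁻ SA b∈ | ∈-++⁻ SA c∈
      ... | inj₁ aA | inj₁ bA | inj₁ cA =
        viaA (triplesA aA bA cA a≢b a≢c b≢c) (λ {_} {β} (ca , cb) _ → ≺-++ʳ β ca , ≺-++ʳ β cb)
      ... | inj₂ aB | inj₂ bB | inj₂ cB =
        viaB (triplesB aB bB cB a≢b a≢c b≢c) (λ {α} _ (ca , cb) → ≺-++ˡ α ca , ≺-++ˡ α cb)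
      ... | inj₂ aB | inj₂ bB | inj₁ cA =
        viaA someA (λ {α} α↭ β↭ → ≺-across α (member cA α↭) (member aB β↭)
                                , ≺-across α (member cA α↭) (member bB β↭))
      ... | inj₁ aA | inj₁ bA | inj₂ cB = here (≺-across SB cB aA , ≺-across SB cB bA)
      ... | inj₁ aA | inj₂ bB | inj₁ cA = first-block aA cA bB a≢c
      ... | inj₂ aB | inj₁ bA | inj₁ cA = Any.map swap (first-block bA cA aB b≢c)
      ... | inj₂ aB | inj₁ bA | inj₂ cB = second-block aB cB bA a≢c
      ... | inj₁ aA | inj₂ bB | inj₂ cB = Any.map swap (second-block bB cB aA b≢c)

  nonempty-any : ∀ {P : List A → Set} {F : Family} {k} → length F ≡ k → 0 < k → All P F → Any P F
  nonempty-any {F = []}    refl () _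
  nonempty-any {F = _ ∷ _} _    _  (p ∷ _) = here p

  merge : ∀ {SA SB k} → 0 < k → Separable SA k → Separable SB k → Separable (SA ++ SB) (2 + k)
  merge {SA} 0<k (FA , |FA| , sepA) (FB , |FB| , sepB) =
    merged , trans length-merged (cong (2 +_) |FA|) ,
    separating orderings (pairs someA) (triples someA)
    where
    open Merge (trans |FA| (sym |FB|)) sepA sepB
    someA : Any (_↭ SA) FA
    someA = nonempty-any |FA| 0<k (Separating.orderings sepA)

  pad : ∀ {S k j} → k ≤ j → Separable S k → Separable S j
  pad {S} {j = j} k≤j (F , refl , separating perms pairs triples) =
    replicate (j ∸ length F) S ++ F , length-padded ,
    separating (All.++⁺ (All.replicate⁺ (j ∸ length F) ↭-refl) perms)
               (λ a∈ b∈ a≢b → Any.++⁺ʳ padding (pairs a∈ b∈ a≢b))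
               (λ a∈ b∈ c∈ a≢b a≢c b≢c → Any.++⁺ʳ padding (triples a∈ b∈ c∈ a≢b a≢c b≢c))
    where
    padding : Family
    padding = replicate (j ∸ length F) S

    length-padded : length (padding ++ F) ≡ j
    length-padded = begin
      length (padding ++ F)          ≡⟨ length-++ padding ⟩
      length padding + length F      ≡⟨ cong (_+ length F) (length-replicate (j ∸ length F)) ⟩
      j ∸ length F + length F        ≡⟨ m∸n+n≡m k≤j ⟩
      j                              ∎
      where open ≡-Reasoning

orderCount : ℕ → ℕ
orderCount zero    = 3
orderCount (suc d) = 2 + orderCount d

orderCount-pos : ∀ d → 0 < orderCount d
orderCount-pos zero    = s≤s z≤n
orderCount-pos (suc d) = s≤s z≤n

module _ {A : Set} where

  take-fits : ∀ h (S : List A) → length (take h S) ≤ h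
  take-fits h S = ≤-trans (≤-reflexive (length-take h S)) (m⊓n≤m h (length S))

  drop-fits : ∀ h (S : List A) → length S ≤ h + h → length (drop h S) ≤ h
  drop-fits h S fits = begin
    length (drop h S) ≡⟨ length-drop h S ⟩
    length S ∸ h      ≤⟨ ∸-monoˡ-≤ h fits ⟩
    h + h ∸ h         ≡⟨ m+n∸m≡n h h ⟩
    h                 ∎
    where open ≤-Reasoning

  doubling : ∀ d (S : List A) → length S ≤ 3 * 2 ^ d → Separable S (orderCount d)
  doubling zero    S small = rotations-separable S small
  doubling (suc d) S fits  =
    subst (λ T → Separable T (orderCount (suc d))) (take++drop≡id h S)
      (merge (orderCount-pos d) (doubling d (take h S) (take-fits h S))
                                (doubling d (drop h S) (drop-fits h S fits-twice)))
    where
    h : ℕ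
    h = 3 * 2 ^ d

    double : ∀ p → 3 * (2 * p) ≡ 3 * p + 3 * p
    double = solve-∀

    fits-twice : length S ≤ h + h
    fits-twice = ≤-trans fits (≤-reflexive (double (2 ^ d)))

module _ {n : ℕ} where

  spine : Fin n → List (Fin n) → Tree n
  spine x []       = leaf x
  spine x (y ∷ ys) = node (spine y ys) (leaf x)

  spine-leaves : ∀ x xs → leaves (spine x xs) ↭ x ∷ xs
  spine-leaves x []       = ↭-refl
  spine-leaves x (y ∷ ys) = ↭-trans (++⁺ʳ [ x ] (spine-leaves y ys)) (↭-sym (∷↭∷ʳ x (y ∷ ys)))

  spine-cherries : ∀ x y ys → cherries (spine x (y ∷ ys)) ≡ 1
  spine-cherries x y []       = refl
  spine-cherries x y (z ∷ zs) = trans (+-identityʳ _) (spine-cherries y z zs)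

  displays-at-root : ∀ {a b} c xs → a ∈ xs → b ∈ xs → Displays (spine c xs) a b c
  displays-at-root c (y ∷ ys) a∈ b∈ =
    inj₂ (inj₂ (inj₁ (in-spine a∈ , in-spine b∈ , here refl)))
    where
    in-spine : ∀ {x} → x ∈ y ∷ ys → x ∈ leaves (spine y ys)
    in-spine = ∈-resp-↭ (↭-sym (spine-leaves y ys))

  spine-displays : ∀ {a b c} x xs → PrecedesBoth c a b (x ∷ xs) → Displays (spine x xs) a b c
  spine-displays x xs       (here a∈ , here b∈)  = displays-at-root x xs a∈ b∈
  spine-displays x xs       (here a∈ , there cb) = displays-at-root x xs a∈ (≺-∈ʳ cb)
  spine-displays x xs       (there ca , here b∈) = displays-at-root x xs (≺-∈ʳ ca) b∈
  spine-displays x (y ∷ ys) (there ca , there cb) = inj₁ (spine-displays y ys (ca , cb))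

  -- The caterpillar of an ordering; the dummy leaf for the empty ordering is never used.
  caterpillar : Fin n → List (Fin n) → Tree n
  caterpillar dummy []       = leaf dummy
  caterpillar _     (x ∷ xs) = spine x xs

  caterpillar-displays : ∀ {a b c} dummy r → PrecedesBoth c a b r →
                         Displays (caterpillar dummy r) a b c
  caterpillar-displays _ (x ∷ xs) = spine-displays x xs

  caterpillar-isCaterpillar : ∀ dummy r → 2 ≤ length r → r ↭ allFin n →
                              IsCaterpillar (caterpillar dummy r)
  caterpillar-isCaterpillar _ (x ∷ y ∷ ys) _ r↭ =
    ↭-trans (spine-leaves x (y ∷ ys)) r↭ , spine-cherries x y ys
  caterpillar-isCaterpillar _ (_ ∷ []) (s≤s ()) _

caterpillar-cover : ∀ n k → 2 ≤ n → Separable (allFin n) k → CatCoverable n k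
caterpillar-cover (suc n) k 2≤n (F , refl , separating perms _ triples) =
  map (caterpillar Fin.zero) F , length-map _ F ,
  All.map⁺ (All.map (λ {r} r↭ → caterpillar-isCaterpillar Fin.zero r (long r↭) r↭) perms) ,
  λ a b c a≢b a≢c b≢c →
    Any.map⁺ (Any.map (caterpillar-displays Fin.zero _)
                      (triples (∈-allFin a) (∈-allFin b) (∈-allFin c) a≢b a≢c b≢c))
  where
  long : ∀ {r} → r ↭ allFin (suc n) → 2 ≤ length r
  long r↭ = ≤-trans 2≤n (≤-reflexive (sym (trans (↭-length r↭) (length-tabulate id))))

caterpillars-are-trees : ∀ n m → CatCoverable n m → TreeCoverable n m
caterpillars-are-trees n m (Ts , |Ts| , cats , covers) = Ts , |Ts| , All.map proj₁ cats , covers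

orderedTriples : ℕ → ℕ
orderedTriples n = n * (n ∸ 1) * (n ∸ 2)

-- The bound is upward closed in k: a step multiplies the left side by 2, the right by 3.
aboveBound-suc : ∀ n k → AboveBound n k → AboveBound n (suc k)
aboveBound-suc n k above = begin
  2 ^ suc k * orderedTriples n   ≡⟨ *-assoc 2 (2 ^ k) (orderedTriples n) ⟩
  2 * (2 ^ k * orderedTriples n) ≤⟨ *-monoʳ-≤ 2 above ⟩
  2 * (2 * 3 ^ k)                ≤⟨ *-monoˡ-≤ (2 * 3 ^ k) {2} {3} (s≤s (s≤s z≤n)) ⟩
  3 * (2 * 3 ^ k)                ≡⟨ exchange (3 ^ k) ⟩
  2 * 3 ^ suc k                  ∎
  where
  open ≤-Reasoning
  exchange : ∀ x → 3 * (2 * x) ≡ 2 * (3 * x)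
  exchange = solve-∀

-- For n ≥ 3 the bound forces k ≥ 3, as n(n-1)(n-2) ≥ 6 and 6·2^k > 2·3^k for k ≤ 2.
aboveBound⇒3≤k : ∀ n k → 3 ≤ n → AboveBound n k → 3 ≤ k
aboveBound⇒3≤k n k n≥3 above = small-k-fails k (≤-trans (*-monoʳ-≤ (2 ^ k) six≤) above)
  where
  six≤ : 6 ≤ orderedTriples n
  six≤ = *-mono-≤ (*-mono-≤ n≥3 (∸-monoˡ-≤ 1 n≥3)) (∸-monoˡ-≤ 2 n≥3)

  small-k-fails : ∀ k → 2 ^ k * 6 ≤ 2 * 3 ^ k → 3 ≤ k
  small-k-fails 0 le = contradiction le (from-no (6 ≤? 2))
  small-k-fails 1 le = contradiction le (from-no (12 ≤? 6))
  small-k-fails 2 le = contradiction le (from-no (24 ≤? 18))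
  small-k-fails (suc (suc (suc _))) _ = s≤s (s≤s (s≤s z≤n))

orderCount-near : ∀ k → 3 ≤ k → ∃[ d ] (orderCount d ≡ k ⊎ suc (orderCount d) ≡ k)
orderCount-near 3 _ = 0 , inj₁ refl
orderCount-near 4 _ = 0 , inj₂ refl
orderCount-near (suc (suc k@(suc (suc (suc _))))) _ =
  Product.map suc (Sum.map (cong (2 +_)) (cong (2 +_))) (orderCount-near k (s≤s (s≤s (s≤s z≤n))))
orderCount-near 0 ()
orderCount-near 1 (s≤s ())
orderCount-near 2 (s≤s (s≤s ()))

pow-orderCount : ∀ b d → b ^ suc (orderCount d) ≡ b * b * b * b * (b ^ d * b ^ d)
pow-orderCount b zero    = fourth b
  where
  fourth : ∀ b → b * (b * (b * (b * 1))) ≡ b * b * b * b * (1 * 1)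
  fourth = solve-∀
pow-orderCount b (suc d) = trans (cong (λ x → b * (b * x)) (pow-orderCount b d)) (shift b (b ^ d))
  where
  shift : ∀ b p → b * (b * (b * b * b * b * (p * p))) ≡ b * b * b * b * (b * p * (b * p))
  shift = solve-∀

three^≤two^² : ∀ d → 3 ^ d ≤ 2 ^ d * 2 ^ d
three^≤two^² zero    = ≤-refl
three^≤two^² (suc d) = begin
  3 * 3 ^ d               ≤⟨ *-mono-≤ {3} {4} (s≤s (s≤s (s≤s z≤n))) (three^≤two^² d) ⟩
  4 * (2 ^ d * 2 ^ d)     ≡⟨ square-double (2 ^ d) ⟩
  2 * 2 ^ d * (2 * 2 ^ d) ∎
  where
  open ≤-Reasoning
  square-double : ∀ p → 4 * (p * p) ≡ 2 * p * (2 * p)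
  square-double = solve-∀

-- If n > 3p with p ≥ 1, then n(n-1)(n-2) ≥ 3p · 3p · 2p = 18p³.
orderedTriples-large : ∀ p n → 1 ≤ p → 3 * p < n → 18 * (p * p * p) ≤ orderedTriples n
orderedTriples-large p@(suc p-1) n _ 3p<n = begin
  18 * (p * p * p)            ≡⟨ factor p ⟩
  3 * p * (3 * p) * (2 * p)   ≤⟨ *-mono-≤ (*-mono-≤ (<⇒≤ 3p<n) (∸-monoˡ-≤ 1 3p<n)) 2p≤n-2 ⟩
  orderedTriples n            ∎
  where
  open ≤-Reasoning
  factor : ∀ p → 18 * (p * p * p) ≡ 3 * p * (3 * p) * (2 * p)
  factor = solve-∀
  2p≤n-2 : 2 * p ≤ n ∸ 2
  2p≤n-2 = ≤-trans (m≤n+m (2 * p) p-1) (∸-monoˡ-≤ 2 3p<n)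

-- Key estimate: for n > 3·2^d the bound fails at k = 2d + 4, since
-- 2·3^(2d+4) ≤ 162·(2^d)⁴ < 288·(2^d)⁵ ≤ 2^(2d+4) · n(n-1)(n-2).
capacity-exceeded : ∀ n d → 3 * 2 ^ d < n →
                    2 * 3 ^ suc (orderCount d) < 2 ^ suc (orderCount d) * orderedTriples n
capacity-exceeded n d 3p<n = begin-strict
  2 * 3 ^ suc (orderCount d)            ≡⟨ cong (2 *_) (pow-orderCount 3 d) ⟩
  2 * (81 * (3 ^ d * 3 ^ d))            ≤⟨ *-monoʳ-≤ 2 (*-monoʳ-≤ 81 (*-mono-≤ (three^≤two^² d) (three^≤two^² d))) ⟩
  2 * (81 * X)                          ≡⟨ collect X ⟩
  162 * X                               <⟨ *-monoˡ-< X (from-yes (162 <? 288)) ⟩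
  288 * X                               ≡⟨ sym (*-identityʳ (288 * X)) ⟩
  288 * X * 1                           ≤⟨ *-monoʳ-≤ (288 * X) p≥1 ⟩
  288 * X * p                           ≡⟨ regroup p ⟩
  16 * (p * p) * (18 * (p * p * p))     ≤⟨ *-monoʳ-≤ (16 * (p * p)) (orderedTriples-large p n p≥1 3p<n) ⟩
  16 * (p * p) * orderedTriples n       ≡⟨ cong (_* orderedTriples n) (sym (pow-orderCount 2 d)) ⟩
  2 ^ suc (orderCount d) * orderedTriples n ∎
  where
  open ≤-Reasoning
  p X : ℕ
  p = 2 ^ d
  X = p * p * (p * p)
  p≥1 : 1 ≤ p
  p≥1 = m^n>0 2 d
  instance
    X-nonZero : NonZero X
    X-nonZero = >-nonZero (*-mono-≤ (*-mono-≤ p≥1 p≥1) (*-mono-≤ p≥1 p≥1))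
  collect : ∀ x → 2 * (81 * x) ≡ 162 * x
  collect = solve-∀
  regroup : ∀ p → 288 * (p * p * (p * p)) * p ≡ 16 * (p * p) * (18 * (p * p * p))
  regroup = solve-∀

capacity-suffices : ∀ n d → AboveBound n (suc (orderCount d)) → n ≤ 3 * 2 ^ d
capacity-suffices n d above = ≮⇒≥ (λ 3p<n → <⇒≱ (capacity-exceeded n d 3p<n) above)

enough-depth : ∀ n k → 3 ≤ n → AboveBound n k → ∃[ d ] n ≤ 3 * 2 ^ d × orderCount d ≤ k
enough-depth n k n≥3 above with orderCount-near k (aboveBound⇒3≤k n k n≥3 above)
... | d , inj₁ count≡k =
  d , capacity-suffices n d (subst (λ j → AboveBound n (suc j)) (sym count≡k) (aboveBound-suc n k above)) ,
  ≤-reflexive count≡k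
... | d , inj₂ count+1≡k =
  d , capacity-suffices n d (subst (AboveBound n) (sym count+1≡k) above) ,
  ≤-trans (n≤1+n (orderCount d)) (≤-reflexive count+1≡k)

lemma21 : (n : ℕ) → 3 ≤ n → (k : ℕ) → IsCeilBound n k →
    ((m : ℕ) → CatCoverable n m → TreeCoverable n m) × CatCoverable n k
lemma21 n n≥3 k (above , _) = caterpillars-are-trees n , covered (enough-depth n k n≥3 above)
  where
  covered : ∃[ d ] n ≤ 3 * 2 ^ d × orderCount d ≤ k → CatCoverable n k
  covered (d , n≤3·2^d , count≤k) =
    caterpillar-cover n k (≤-trans (n≤1+n 2) n≥3)
      (pad count≤k (doubling d (allFin n) (≤-trans (≤-reflexive (length-tabulate id)) n≤3·2^d)))
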